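{- The solutions of the equation $2^r\cdot 3^s + 1 = y^n$ in positive integers $r,s,y,n$ with $y>1$ and $n>1$ are exactly $(r,s,y,n) = (3,1,5,2)$, $(4,1,7,2)$ and $(5,2,17,2)$. -}

{-# OPTIONS --safe #-}
module Submission where

-- Write N = 2^r 3^s.  If n = 2m, then Y = y^m is odd, say Y = 2q + 1, and N = 4q(q + 1); so q and
-- q + 1 are consecutive 3-smooth numbers.  Being coprime, one is a power of 2 and the other a power
-- of 3, and the equations 1 + 3^b = 2^c and 1 + 2^a = 3^d (settled modulo 8 and 80) leave
-- q ∈ {1, 2, 3, 8}.  Hence Y ∈ {5, 7, 17} (q = 1 would force s = 0), and as Y is prime, y = Y, n = 2.
-- If n is odd, then y ≡ 1 (mod 6) since x^n ≡ x (mod 6).  The repunit 1 + y + ⋯ + y^(n-1) divides N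
-- and is ≡ n (mod 6), so it is odd, hence a power of 3 exceeding 1, and therefore 3 ∣ n.  Then
-- Y = y^(n/3) satisfies Y³ = N + 1 with Y ≡ 1 (mod 3), so 1 + Y + Y² is a power of 3 that is
-- ≡ 3 (mod 9); it must be 3, i.e. Y = 1, which is absurd.

open import Data.Nat using (ℕ; zero; suc; _+_; _*_; _^_; _<_; _≤_; _%_; _/_; NonZero; ≢-nonZero⁻¹; z≤n; s≤s)
open import Data.Nat.Properties
open import Data.Nat.DivMod
open import Data.Nat.Divisibility
open import Data.Nat.Coprimality using (Coprime; coprime-divisor)
open import Data.Nat.Primality using (Prime; prime?; prime[2]; ¬prime[1]; prime⇒nonZero; prime⇒irreducible)
open import Data.Nat.Tactic.RingSolver using (solve-∀)
open import Data.List using (List; []; _∷_)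
open import Data.List.Membership.Propositional using (_∈_)
open import Data.List.Membership.DecPropositional _≟_ using (_∈?_)
open import Data.List.Relation.Unary.All using (all?; lookup)
open import Data.List.Relation.Unary.Any using (here)
open import Data.Product using (_×_; _,_; proj₂; map₂; ∃; ∃₂)
open import Data.Sum using (_⊎_; inj₁; inj₂)
open import Data.Empty using (⊥; ⊥-elim)
open import Function using (_∘_)
open import Function.Bundles using (_⇔_; mk⇔)
open import Relation.Nullary using (¬_; ¬?; yes; no; contradiction)
open import Relation.Nullary.Decidable using (True; toWitness; from-yes)
open import Relation.Binary.Definitions using (tri<; tri≈; tri>)
open import Relation.Binary.PropositionalEquality

module _ {d : ℕ} .{{_ : NonZero d}} where
  open ≡-Reasoning

  +-cong-% : ∀ {m n o p} → m % d ≡ n % d → o % d ≡ p % d → (m + o) % d ≡ (n + p) % d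
  +-cong-% {m} {n} {o} {p} m≡n o≡p = begin
    (m + o) % d           ≡⟨ %-distribˡ-+ m o d ⟩
    (m % d + o % d) % d   ≡⟨ cong₂ (λ x y → (x + y) % d) m≡n o≡p ⟩
    (n % d + p % d) % d   ≡⟨ %-distribˡ-+ n p d ⟨
    (n + p) % d           ∎

  *-cong-% : ∀ {m n o p} → m % d ≡ n % d → o % d ≡ p % d → (m * o) % d ≡ (n * p) % d
  *-cong-% {m} {n} {o} {p} m≡n o≡p = begin
    (m * o) % d           ≡⟨ %-distribˡ-* m o d ⟩
    (m % d * (o % d)) % d ≡⟨ cong₂ (λ x y → (x * y) % d) m≡n o≡p ⟩
    (n % d * (p % d)) % d ≡⟨ %-distribˡ-* n p d ⟨
    (n * p) % d           ∎

  %-distribˡ-^ : ∀ m n → m ^ n % d ≡ (m % d) ^ n % d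
  %-distribˡ-^ m zero    = refl
  %-distribˡ-^ m (suc n) = *-cong-% (sym (m%n%n≡m%n m d)) (%-distribˡ-^ m n)

  m%n≡r⇒m≡r+[m/n]*n : ∀ {m r} → m % d ≡ r → m ≡ r + m / d * d
  m%n≡r⇒m≡r+[m/n]*n {m} m%d≡r = trans (m≡m%n+[m/n]*n m d) (cong (_+ m / d * d) m%d≡r)

  -- The closure condition (like `disjoint` below) is a decision evaluated by the type checker,
  -- so for concrete d and A it is discharged automatically.
  ^-%-orbit : ∀ b {A : List ℕ} {k} {closed : True (all? (λ x → b * x % d ∈? A) A)} →
              b ^ k % d ∈ A → ∀ n → b ^ (k + n) % d ∈ A
  ^-%-orbit b {A} {k} start zero = subst (λ e → b ^ e % d ∈ A) (sym (+-identityʳ k)) start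
  ^-%-orbit b {A} {k} {closed} start (suc n) =
    subst (_∈ A) step (lookup (toWitness closed) (^-%-orbit b {k = k} {closed} start n))
    where
    step : b * (b ^ (k + n) % d) % d ≡ b ^ (k + suc n) % d
    step = trans (*-cong-% {m = b} refl (m%n%n≡m%n (b ^ (k + n)) d))
                 (cong (λ e → b ^ e % d) (sym (+-suc k n)))

  residue-obstruction : ∀ {a b} {A B : List ℕ} → a % d ∈ A → b % d ∈ B →
                        {disjoint : True (all? (λ u → all? (λ v → ¬? (suc u % d ≟ v)) B) A)} →
                        1 + a ≢ b
  residue-obstruction {a} {b} a∈A b∈B {disjoint} eq =
    lookup (lookup (toWitness disjoint) a∈A) b∈B (begin
      suc (a % d) % d  ≡⟨ +-cong-% {m = 1} refl (m%n%n≡m%n a d) ⟩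
      (1 + a) % d      ≡⟨ cong (_% d) eq ⟩
      b % d            ∎)

cube-%6 : ∀ x → x ^ 3 % 6 ≡ x % 6
cube-%6 x = trans (%-distribˡ-^ x 3) (on-residues (x % 6) (m%n<n x 6))
  where
  on-residues : ∀ r → r < 6 → r ^ 3 % 6 ≡ r
  on-residues 0 _ = refl
  on-residues 1 _ = refl
  on-residues 2 _ = refl
  on-residues 3 _ = refl
  on-residues 4 _ = refl
  on-residues 5 _ = refl
  on-residues (suc (suc (suc (suc (suc (suc _)))))) (s≤s (s≤s (s≤s (s≤s (s≤s (s≤s ()))))))

odd-power-%6 : ∀ x m → x ^ (1 + m * 2) % 6 ≡ x % 6
odd-power-%6 x zero    = cong (_% 6) (*-identityʳ x)
odd-power-%6 x (suc m) = begin
  x * (x * x ^ (1 + m * 2)) % 6  ≡⟨ *-cong-% {6} {x} {x} refl (*-cong-% {6} {x} {x} refl ih) ⟩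
  x * (x * x) % 6                ≡⟨ cong (λ z → x * (x * z) % 6) (*-identityʳ x) ⟨
  x ^ 3 % 6                      ≡⟨ cube-%6 x ⟩
  x % 6                          ∎
  where
  open ≡-Reasoning
  ih : x ^ (1 + m * 2) % 6 ≡ x % 6
  ih = odd-power-%6 x m

odd-root-%6 : ∀ {y N} m → 6 ∣ N → y ^ (1 + m * 2) ≡ 1 + N → y % 6 ≡ 1
odd-root-%6 {y} {N} m 6∣N eq = begin
  y % 6                  ≡⟨ odd-power-%6 y m ⟨
  y ^ (1 + m * 2) % 6    ≡⟨ cong (_% 6) eq ⟩
  (1 + N) % 6            ≡⟨ %-remove-+ʳ 1 6∣N ⟩
  1                      ∎
  where open ≡-Reasoning

%6≡1⇒%d≡1 : ∀ {x} d .{{_ : NonZero d}} → d ∣ 6 → x % 6 ≡ 1 → x % d ≡ 1 % d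
%6≡1⇒%d≡1 {x} d d∣6 x%6≡1 = trans (sym (m∣n⇒o%n%m≡o%m d 6 x d∣6)) (cong (_% d) x%6≡1)

square-%2 : ∀ {Y N} → 2 ∣ N → Y ^ 2 ≡ 1 + N → Y % 2 ≡ 1
square-%2 {Y} {N} 2∣N eq = on-residues (Y % 2) (m%n<n Y 2) (begin
  (Y % 2) ^ 2 % 2  ≡⟨ %-distribˡ-^ Y 2 ⟨
  Y ^ 2 % 2        ≡⟨ cong (_% 2) eq ⟩
  (1 + N) % 2      ≡⟨ %-remove-+ʳ 1 2∣N ⟩
  1                ∎)
  where
  open ≡-Reasoning
  on-residues : ∀ r → r < 2 → r ^ 2 % 2 ≡ 1 → r ≡ 1
  on-residues 1 _ _ = refl
  on-residues (suc (suc _)) (s≤s (s≤s ())) _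

^-injectiveʳ : ∀ m {a b} → 1 < m → m ^ a ≡ m ^ b → a ≡ b
^-injectiveʳ m {a} {b} 1<m eq with <-cmp a b
... | tri< a<b _ _ = ⊥-elim (<-irrefl eq (^-monoʳ-< m 1<m a<b))
... | tri≈ _ a≡b _ = a≡b
... | tri> _ _ b<a = ⊥-elim (<-irrefl (sym eq) (^-monoʳ-< m 1<m b<a))

prime-power-root : ∀ {p y m} → Prime p → 1 < y → y ^ m ≡ p → y ≡ p × m ≡ 1
prime-power-root {m = zero} p-prime _ refl = ⊥-elim (¬prime[1] p-prime)
prime-power-root {y = y} {suc m} p-prime 1<y eq
  with prime⇒irreducible p-prime (divides (y ^ m) (trans (sym eq) (*-comm y (y ^ m))))
... | inj₁ refl = ⊥-elim (<-irrefl refl 1<y)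
... | inj₂ refl = refl , ^-injectiveʳ y 1<y (trans eq (sym (*-identityʳ y)))

repunit : ℕ → ℕ → ℕ
repunit y zero    = 0
repunit y (suc n) = 1 + y * repunit y n

repunit-geometric : ∀ w n → 1 + w * repunit (suc w) n ≡ suc w ^ n
repunit-geometric w zero    = cong suc (*-zeroʳ w)
repunit-geometric w (suc n) = trans (unfold w (repunit (suc w) n)) (cong (suc w *_) (repunit-geometric w n))
  where
  unfold : ∀ w R → 1 + w * (1 + (1 + w) * R) ≡ (1 + w) * (1 + w * R)
  unfold = solve-∀

repunit-∣ : ∀ w n {N} → suc w ^ n ≡ 1 + N → repunit (suc w) n ∣ N
repunit-∣ w n eq = divides w (sym (suc-injective (trans (repunit-geometric w n) eq)))

repunit-% : ∀ {y d} .{{_ : NonZero d}} → y % d ≡ 1 % d → ∀ n → repunit y n % d ≡ n % d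
repunit-% y≡1 zero    = refl
repunit-% {y} {d} y≡1 (suc n) =
  +-cong-% {m = 1} refl (trans (*-cong-% y≡1 (repunit-% y≡1 n)) (cong (_% d) (*-identityˡ n)))

repunit-cube : ∀ t → repunit (1 + t * 3) 3 ≡ 3 + (t + t * t) * 9
repunit-cube = expand
  where
  expand : ∀ t → 1 + (1 + t * 3) * (1 + (1 + t * 3) * (1 + (1 + t * 3) * 0)) ≡ 3 + (t + t * t) * 9
  expand = solve-∀

-- 1 + Y + Y² ≡ 3 (mod 9) when Y ≡ 1 (mod 3), and the only power of 3 with that residue is 3 itself.
repunit-cube≡3^d⇒t≡0 : ∀ t d → repunit (1 + t * 3) 3 ≡ 3 ^ d → t ≡ 0
repunit-cube≡3^d⇒t≡0 t d eq = by-exponent d (trans (sym (repunit-cube t)) eq)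
  where
  open ≡-Reasoning
  nine-divides : ∀ x → 3 * (3 * x) ≡ x * 9
  nine-divides = solve-∀
  by-exponent : ∀ d → 3 + (t + t * t) * 9 ≡ 3 ^ d → t ≡ 0
  by-exponent zero ()
  by-exponent 1 eq = m+n≡0⇒m≡0 t (m*n≡0⇒m≡0 _ 9 (+-cancelˡ-≡ 3 _ 0 eq))
  by-exponent (suc (suc d)) eq = contradiction (begin
    3                          ≡⟨ [m+kn]%n≡m%n 3 (t + t * t) 9 ⟨
    (3 + (t + t * t) * 9) % 9  ≡⟨ cong (_% 9) eq ⟩
    3 ^ (2 + d) % 9            ≡⟨ n∣m⇒m%n≡0 _ 9 (divides (3 ^ d) (nine-divides (3 ^ d))) ⟩
    0                          ∎) λ ()

split-off-prime-power : ∀ {p} → Prime p → ∀ a {n D} → D ∣ p ^ a * n →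
                        ∃₂ λ c D′ → D ≡ p ^ c * D′ × D′ ∣ n
split-off-prime-power _ zero {n} {D} D∣n =
  0 , D , sym (*-identityˡ D) , subst (D ∣_) (*-identityˡ n) D∣n
split-off-prime-power {p} p-prime (suc a) {n} {D} D∣ with p ∣? D
... | yes (divides D₁ refl) =
  let c , D′ , D₁≡ , D′∣n =
        split-off-prime-power p-prime a (*-cancelˡ-∣ p {{prime⇒nonZero p-prime}} pD₁∣)
  in suc c , D′ , trans (cong (_* p) D₁≡) (pull-out p (p ^ c) D′) , D′∣n
  where
  pD₁∣ : p * D₁ ∣ p * (p ^ a * n)
  pD₁∣ = subst₂ _∣_ (*-comm D₁ p) (*-assoc p (p ^ a) n) D∣
  pull-out : ∀ p x y → x * y * p ≡ p * x * y
  pull-out = solve-∀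
... | no p∤D =
  split-off-prime-power p-prime a (coprime-divisor D⊥p (subst (D ∣_) (*-assoc p (p ^ a) n) D∣))
  where
  D⊥p : Coprime D p
  D⊥p (i∣D , i∣p) with prime⇒irreducible p-prime i∣p
  ... | inj₁ i≡1  = i≡1
  ... | inj₂ refl = ⊥-elim (p∤D i∣D)

3-Smooth : ℕ → Set
3-Smooth n = ∃₂ λ a b → n ≡ 2 ^ a * 3 ^ b

prime[3] : Prime 3
prime[3] = from-yes (prime? 3)

∣-3-smooth : ∀ a b {D} → D ∣ 2 ^ a * 3 ^ b → 3-Smooth D
∣-3-smooth a b {D} D∣ with split-off-prime-power prime[2] a D∣
... | c , D′ , refl , D′∣3^b
  with split-off-prime-power prime[3] b (subst (D′ ∣_) (sym (*-identityʳ (3 ^ b))) D′∣3^b)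
...   | e , D″ , refl , D″∣1 =
  c , e , cong (2 ^ c *_) (trans (cong (3 ^ e *_) (∣1⇒≡1 D″∣1)) (*-identityʳ (3 ^ e)))

2∣2^[1+a]*3^b : ∀ a b → 2 ∣ 2 ^ suc a * 3 ^ b
2∣2^[1+a]*3^b a b = ∣m⇒∣m*n (3 ^ b) (m∣m*n (2 ^ a))

3∣2^a*3^[1+b] : ∀ a b → 3 ∣ 2 ^ a * 3 ^ suc b
3∣2^a*3^[1+b] a b = ∣n⇒∣m*n (2 ^ a) (m∣m*n (3 ^ b))

2∤3^b : ∀ b → ¬ 2 ∣ 3 ^ b
2∤3^b b 2∣3^b = contradiction (trans (sym 3^b%2≡1) (n∣m⇒m%n≡0 _ 2 2∣3^b)) λ ()
  where
  3^b%2≡1 : 3 ^ b % 2 ≡ 1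
  3^b%2≡1 = trans (%-distribˡ-^ 3 b) (cong (_% 2) (^-zeroˡ b))

odd-3-smooth⇒power-of-3 : ∀ {x} → 3-Smooth x → x % 2 ≡ 1 → ∃ λ e → x ≡ 3 ^ e
odd-3-smooth⇒power-of-3 (zero  , e , refl) _   = e , *-identityˡ (3 ^ e)
odd-3-smooth⇒power-of-3 (suc c , e , refl) odd =
  contradiction (trans (sym odd) (n∣m⇒m%n≡0 _ 2 (2∣2^[1+a]*3^b c e))) λ ()

2^a*3^b-injective : ∀ a b c d → 2 ^ a * 3 ^ b ≡ 2 ^ c * 3 ^ d → a ≡ c × b ≡ d
2^a*3^b-injective zero b zero d eq =
  refl , ^-injectiveʳ 3 (s≤s (s≤s z≤n)) (trans (sym (*-identityˡ _)) (trans eq (*-identityˡ _)))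
2^a*3^b-injective (suc a) b (suc c) d eq =
  let a≡c , b≡d = 2^a*3^b-injective a b c d
          (*-cancelˡ-≡ _ _ 2 (trans (sym (*-assoc 2 (2 ^ a) (3 ^ b))) (trans eq (*-assoc 2 (2 ^ c) (3 ^ d)))))
  in cong suc a≡c , b≡d
2^a*3^b-injective zero b (suc c) d eq =
  ⊥-elim (2∤3^b b (subst (2 ∣_) (trans (sym eq) (*-identityˡ (3 ^ b))) (2∣2^[1+a]*3^b c d)))
2^a*3^b-injective (suc a) b zero d eq =
  ⊥-elim (2∤3^b d (subst (2 ∣_) (trans eq (*-identityˡ (3 ^ d))) (2∣2^[1+a]*3^b a b)))

3^n%8 : ∀ n → 3 ^ n % 8 ∈ 1 ∷ 3 ∷ []
3^n%8 = ^-%-orbit 3 {k = 0} (here refl)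

2^[3+n]%8 : ∀ n → 2 ^ (3 + n) % 8 ∈ 0 ∷ []
2^[3+n]%8 = ^-%-orbit 2 {k = 3} (here refl)

3^n%80 : ∀ n → 3 ^ n % 80 ∈ 1 ∷ 3 ∷ 9 ∷ 27 ∷ []
3^n%80 = ^-%-orbit 3 {k = 0} (here refl)

2^[4+n]%80 : ∀ n → 2 ^ (4 + n) % 80 ∈ 16 ∷ 32 ∷ 64 ∷ 48 ∷ []
2^[4+n]%80 = ^-%-orbit 2 {k = 4} (here refl)

1+3^b≡2^c⇒b≤1 : ∀ b c → 1 + 3 ^ b ≡ 2 ^ c → b ≡ 0 ⊎ b ≡ 1
1+3^b≡2^c⇒b≤1 b 0 = ⊥-elim ∘ residue-obstruction (3^n%8 b) (here {xs = []} refl)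
1+3^b≡2^c⇒b≤1 b 1 = inj₁ ∘ ^-injectiveʳ 3 (s≤s (s≤s z≤n)) ∘ suc-injective
1+3^b≡2^c⇒b≤1 b 2 = inj₂ ∘ ^-injectiveʳ 3 (s≤s (s≤s z≤n)) ∘ suc-injective
1+3^b≡2^c⇒b≤1 b (suc (suc (suc c))) = ⊥-elim ∘ residue-obstruction (3^n%8 b) (2^[3+n]%8 c)

1+2^a≡3^d⇒a≡1∨a≡3 : ∀ a d → 1 + 2 ^ a ≡ 3 ^ d → a ≡ 1 ⊎ a ≡ 3
1+2^a≡3^d⇒a≡1∨a≡3 0 d = ⊥-elim ∘ residue-obstruction (here {xs = []} refl) (3^n%80 d)
1+2^a≡3^d⇒a≡1∨a≡3 1 d = λ _ → inj₁ refl
1+2^a≡3^d⇒a≡1∨a≡3 2 d = ⊥-elim ∘ residue-obstruction (here {xs = []} refl) (3^n%80 d)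
1+2^a≡3^d⇒a≡1∨a≡3 3 d = λ _ → inj₂ refl
1+2^a≡3^d⇒a≡1∨a≡3 (suc (suc (suc (suc a)))) d = ⊥-elim ∘ residue-obstruction (2^[4+n]%80 a) (3^n%80 d)

∣⇒∤1+ : ∀ {p u} → 1 < p → p ∣ u → ¬ p ∣ 1 + u
∣⇒∤1+ {p} {u} 1<p p∣u p∣1+u =
  <-irrefl (sym (∣1⇒≡1 (∣m+n∣m⇒∣n (subst (p ∣_) (+-comm 1 u) p∣1+u) p∣u))) 1<p

consecutive⇒2-exponent≡0 : ∀ a b c d → 1 + 2 ^ a * 3 ^ b ≡ 2 ^ c * 3 ^ d → a ≡ 0 ⊎ c ≡ 0
consecutive⇒2-exponent≡0 zero    b c       d _  = inj₁ refl
consecutive⇒2-exponent≡0 (suc a) b zero    d _  = inj₂ refl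
consecutive⇒2-exponent≡0 (suc a) b (suc c) d eq = ⊥-elim
  (∣⇒∤1+ (s≤s (s≤s z≤n)) (2∣2^[1+a]*3^b a b) (subst (2 ∣_) (sym eq) (2∣2^[1+a]*3^b c d)))

consecutive⇒3-exponent≡0 : ∀ a b c d → 1 + 2 ^ a * 3 ^ b ≡ 2 ^ c * 3 ^ d → b ≡ 0 ⊎ d ≡ 0
consecutive⇒3-exponent≡0 a zero    c d       _  = inj₁ refl
consecutive⇒3-exponent≡0 a (suc b) c zero    _  = inj₂ refl
consecutive⇒3-exponent≡0 a (suc b) c (suc d) eq = ⊥-elim
  (∣⇒∤1+ (s≤s (s≤s z≤n)) (3∣2^a*3^[1+b] a b) (subst (3 ∣_) (sym eq) (3∣2^a*3^[1+b] c d)))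

consecutive-3-smooth : ∀ {q} → 3-Smooth q → 3-Smooth (1 + q) → q ≡ 1 ⊎ q ≡ 2 ⊎ q ≡ 3 ⊎ q ≡ 8
consecutive-3-smooth (a , b , refl) (c , d , eq)
  with consecutive⇒2-exponent≡0 a b c d eq | consecutive⇒3-exponent≡0 a b c d eq
... | inj₁ refl | inj₁ refl = inj₁ refl
... | inj₁ refl | inj₂ refl
  with 1+3^b≡2^c⇒b≤1 b c (trans (cong suc (sym (*-identityˡ (3 ^ b)))) (trans eq (*-identityʳ (2 ^ c))))
...   | inj₁ refl = inj₁ refl
...   | inj₂ refl = inj₂ (inj₂ (inj₁ refl))
consecutive-3-smooth (a , b , refl) (c , d , eq) | inj₂ refl | inj₁ refl
  with 1+2^a≡3^d⇒a≡1∨a≡3 a d (trans (cong suc (sym (*-identityʳ (2 ^ a)))) (trans eq (*-identityˡ (3 ^ d))))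
...   | inj₁ refl = inj₂ (inj₁ refl)
...   | inj₂ refl = inj₂ (inj₂ (inj₂ refl))
consecutive-3-smooth (a , b , refl) (c , d , eq) | inj₂ refl | inj₂ refl =
  ⊥-elim (≢-nonZero⁻¹ _ {{m*n≢0 (2 ^ a) (3 ^ b) {{m^n≢0 2 a}} {{m^n≢0 3 b}}}} (suc-injective eq))

Solution : ℕ → ℕ → ℕ → ℕ → Set
Solution r s y n =
  (r ≡ 3 × s ≡ 1 × y ≡ 5 × n ≡ 2) ⊎ (r ≡ 4 × s ≡ 1 × y ≡ 7 × n ≡ 2) ⊎ (r ≡ 5 × s ≡ 2 × y ≡ 17 × n ≡ 2)

4q[1+q]-solutions : ∀ q r s → q * (1 + q) * 4 ≡ 2 ^ r * 3 ^ suc s → Solution r (suc s) (1 + q * 2) 2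
4q[1+q]-solutions q r s eq
  with consecutive-3-smooth (∣-3-smooth r (suc s) (subst (q ∣_) eq (∣m⇒∣m*n 4 (m∣m*n (1 + q)))))
                            (∣-3-smooth r (suc s) (subst (1 + q ∣_) eq (n∣m*n*o q 4)))
... | inj₁ refl = contradiction (proj₂ (2^a*3^b-injective 3 0 r (suc s) eq)) λ ()
... | inj₂ (inj₁ refl) with 2^a*3^b-injective 3 1 r (suc s) eq
...   | refl , refl = inj₁ (refl , refl , refl , refl)
4q[1+q]-solutions q r s eq | inj₂ (inj₂ (inj₁ refl)) with 2^a*3^b-injective 4 1 r (suc s) eq
...   | refl , refl = inj₂ (inj₁ (refl , refl , refl , refl))
4q[1+q]-solutions q r s eq | inj₂ (inj₂ (inj₂ refl)) with 2^a*3^b-injective 5 2 r (suc s) eq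
...   | refl , refl = inj₂ (inj₂ (refl , refl , refl , refl))

square-solutions : ∀ r s Y → Y ^ 2 ≡ 1 + 2 ^ suc r * 3 ^ suc s → Solution (suc r) (suc s) Y 2
square-solutions r s Y eq =
  subst (λ Y → Solution (suc r) (suc s) Y 2) (sym Y≡1+2q) (4q[1+q]-solutions q (suc r) s 4q[1+q]≡N)
  where
  open ≡-Reasoning
  q : ℕ
  q = Y / 2
  Y≡1+2q : Y ≡ 1 + q * 2
  Y≡1+2q = m%n≡r⇒m≡r+[m/n]*n {2} (square-%2 {Y} (2∣2^[1+a]*3^b r (suc s)) eq)
  odd-square : ∀ q → (1 + q * 2) * ((1 + q * 2) * 1) ≡ 1 + q * (1 + q) * 4
  odd-square = solve-∀
  4q[1+q]≡N : q * (1 + q) * 4 ≡ 2 ^ suc r * 3 ^ suc s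
  4q[1+q]≡N = suc-injective (begin
    1 + q * (1 + q) * 4  ≡⟨ odd-square q ⟨
    (1 + q * 2) ^ 2      ≡⟨ cong (_^ 2) Y≡1+2q ⟨
    Y ^ 2                ≡⟨ eq ⟩
    1 + 2 ^ suc r * 3 ^ suc s ∎)

6∣2^[1+a]*3^[1+b] : ∀ a b → 6 ∣ 2 ^ suc a * 3 ^ suc b
6∣2^[1+a]*3^[1+b] a b = *-pres-∣ (m∣m*n {2} (2 ^ a)) (m∣m*n {3} (3 ^ b))

repunit-power-of-3 : ∀ r s w m → suc w ^ (1 + m * 2) ≡ 1 + 2 ^ suc r * 3 ^ suc s →
                     ∃ λ e → repunit (suc w) (1 + m * 2) ≡ 3 ^ e
repunit-power-of-3 r s w m eq =
  odd-3-smooth⇒power-of-3 (∣-3-smooth (suc r) (suc s) (repunit-∣ w (1 + m * 2) eq)) repunit-odd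
  where
  y-odd : suc w % 2 ≡ 1
  y-odd = %6≡1⇒%d≡1 {suc w} 2 (divides 3 refl) (odd-root-%6 {suc w} m (6∣2^[1+a]*3^[1+b] r s) eq)
  repunit-odd : repunit (suc w) (1 + m * 2) % 2 ≡ 1
  repunit-odd = trans (repunit-% {suc w} {2} y-odd (1 + m * 2)) ([m+kn]%n≡m%n 1 m 2)

no-cube : ∀ r s Y → 1 < Y → Y ^ 3 ≢ 1 + 2 ^ suc r * 3 ^ suc s
no-cube r s (suc w) 1<Y eq with repunit-power-of-3 r s w 1 eq
... | e , repunit≡3^e = <-irrefl (sym Y≡1) 1<Y
  where
  t : ℕ
  t = suc w / 3
  Y≡1+3t : suc w ≡ 1 + t * 3
  Y≡1+3t = m%n≡r⇒m≡r+[m/n]*n {3}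
    (%6≡1⇒%d≡1 {suc w} 3 (divides 2 refl) (odd-root-%6 {suc w} 1 (6∣2^[1+a]*3^[1+b] r s) eq))
  t≡0 : t ≡ 0
  t≡0 = repunit-cube≡3^d⇒t≡0 t e (subst (λ Y → repunit Y 3 ≡ 3 ^ e) Y≡1+3t repunit≡3^e)
  Y≡1 : suc w ≡ 1
  Y≡1 = trans Y≡1+3t (cong (λ t → 1 + t * 3) t≡0)

odd-exponent≡1 : ∀ r s y m → 1 < y → y ^ (1 + m * 2) ≡ 1 + 2 ^ suc r * 3 ^ suc s → m ≡ 0
odd-exponent≡1 r s y zero _ _ = refl
odd-exponent≡1 r s (suc w) (suc m) 1<y eq with repunit-power-of-3 r s w (suc m) eq
... | zero  , ()   -- a repunit of length at least 2 exceeds 1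
... | suc e , repunit≡3^[1+e] = ⊥-elim (no-cube r s (y ^ k) 1<y^k (begin
  (y ^ k) ^ 3  ≡⟨ ^-*-assoc y k 3 ⟩
  y ^ (k * 3)  ≡⟨ cong (y ^_) n≡k*3 ⟨
  y ^ n        ≡⟨ eq ⟩
  1 + 2 ^ suc r * 3 ^ suc s ∎))
  where
  open ≡-Reasoning
  y n k : ℕ
  y = suc w
  n = 1 + suc m * 2
  k = n / 3
  y%3≡1 : y % 3 ≡ 1
  y%3≡1 = %6≡1⇒%d≡1 {y} 3 (divides 2 refl) (odd-root-%6 {y} (suc m) (6∣2^[1+a]*3^[1+b] r s) eq)
  n%3≡0 : n % 3 ≡ 0
  n%3≡0 = begin
    n % 3              ≡⟨ repunit-% {y} {3} y%3≡1 n ⟨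
    repunit y n % 3    ≡⟨ cong (_% 3) repunit≡3^[1+e] ⟩
    3 ^ suc e % 3      ≡⟨ n∣m⇒m%n≡0 _ 3 (m∣m*n (3 ^ e)) ⟩
    0                  ∎
  n≡k*3 : n ≡ k * 3
  n≡k*3 = m%n≡r⇒m≡r+[m/n]*n {3} n%3≡0
  1<y^k : 1 < y ^ k
  1<y^k = ^-monoʳ-< y 1<y {0} {k} (n≢0⇒n>0 λ k≡0 → contradiction (trans n≡k*3 (cong (_* 3) k≡0)) λ ())

power-base-solution : ∀ {r s y m} → 1 < y → Solution r s (y ^ m) 2 → Solution r s y (m * 2)
power-base-solution {m = m} 1<y (inj₁ (r≡ , s≡ , y^m≡5 , _)) =
  inj₁ (r≡ , s≡ , map₂ (cong (_* 2)) (prime-power-root {m = m} (from-yes (prime? 5)) 1<y y^m≡5))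
power-base-solution {m = m} 1<y (inj₂ (inj₁ (r≡ , s≡ , y^m≡7 , _))) =
  inj₂ (inj₁ (r≡ , s≡ , map₂ (cong (_* 2)) (prime-power-root {m = m} (from-yes (prime? 7)) 1<y y^m≡7)))
power-base-solution {m = m} 1<y (inj₂ (inj₂ (r≡ , s≡ , y^m≡17 , _))) =
  inj₂ (inj₂ (r≡ , s≡ , map₂ (cong (_* 2)) (prime-power-root {m = m} (from-yes (prime? 17)) 1<y y^m≡17)))

even-or-odd : ∀ n → ∃ λ m → n ≡ m * 2 ⊎ n ≡ 1 + m * 2
even-or-odd 0 = 0 , inj₁ refl
even-or-odd 1 = 0 , inj₂ refl
even-or-odd (suc (suc n)) with even-or-odd n
... | m , inj₁ refl = suc m , inj₁ refl
... | m , inj₂ refl = suc m , inj₂ refl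

lemma2p11 : (r s y n : ℕ) → 1 ≤ r → 1 ≤ s → 1 < y → 1 < n →
    ((2 ^ r * 3 ^ s + 1 ≡ y ^ n) ⇔
      ((r ≡ 3 × s ≡ 1 × y ≡ 5 × n ≡ 2) ⊎ (r ≡ 4 × s ≡ 1 × y ≡ 7 × n ≡ 2) ⊎ (r ≡ 5 × s ≡ 2 × y ≡ 17 × n ≡ 2)))
lemma2p11 (suc r) (suc s) y n (s≤s z≤n) (s≤s z≤n) 1<y 1<n =
  mk⇔ (λ eq → solve (trans (sym eq) (+-comm _ 1))) verify
  where
  solve : y ^ n ≡ 1 + 2 ^ suc r * 3 ^ suc s → Solution (suc r) (suc s) y n
  solve eq with even-or-odd n
  ... | m , inj₁ refl =
    power-base-solution {m = m} 1<y (square-solutions r s (y ^ m) (trans (^-*-assoc y m 2) eq))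
  ... | m , inj₂ refl with odd-exponent≡1 r s y m 1<y eq
  ...   | refl = contradiction 1<n (<-irrefl refl)
  verify : Solution (suc r) (suc s) y n → 2 ^ suc r * 3 ^ suc s + 1 ≡ y ^ n
  verify (inj₁ (refl , refl , refl , refl))        = refl
  verify (inj₂ (inj₁ (refl , refl , refl , refl))) = refl
  verify (inj₂ (inj₂ (refl , refl , refl , refl))) = refl
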